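{- Let $h_1\ge\dots\ge h_n>0$ be integers with $n\ge 2$ and $N=h_1+\dots+h_n$. If a $\mathrm{LC}(h_1\dots h_n)$ exists, then $h_i\le N/2$ for all $1\le i\le n$.
   Context: A latin cube of order $N$ is an $N\times N\times N$ array on $N$ symbols such that any two cells whose coordinates differ in exactly one position contain different symbols; a subcube is an $m\times m\times m$ subarray (indices in each coordinate from chosen $m$-sets) that is itself a latin cube of order $m$; subcubes are disjoint if they share no index in any coordinate and no symbol. A $\mathrm{LC}(h_1\dots h_n)$ is a latin cube of order $N=\sum h_i$ with pairwise disjoint subcubes of orders $h_1,\dots,h_n$. -}

module Defs where

open import Data.Nat using (ℕ)
open import Data.Fin using (Fin)
open import Data.List using (map; allFin)
open import Data.Nat.ListAction using (sum)
open import Data.Product using (∃)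
open import Relation.Binary.PropositionalEquality using (_≡_; _≢_)
open import Function.Definitions using (Injective)

Cube : ℕ → Set
Cube N = Fin N → Fin N → Fin N → Fin N

record IsLatinCube {N : ℕ} (L : Cube N) : Set where
  field
    line₁ : ∀ {i i′} j k → i ≢ i′ → L i j k ≢ L i′ j k
    line₂ : ∀ i {j j′} k → j ≢ j′ → L i j k ≢ L i j′ k
    line₃ : ∀ i j {k k′} → k ≢ k′ → L i j k ≢ L i j k′

-- A subcube of order m of L: three m-sets of indices (given by injective
-- maps Fin m → Fin N), an m-set of symbols (injective map sym), such that
-- the subarray is a latin cube of order m on those m symbols.
record Subcube {N : ℕ} (L : Cube N) (m : ℕ) : Set where
  field
    idx₁ idx₂ idx₃ sym : Fin m → Fin N
    idx₁-inj : Injective _≡_ _≡_ idx₁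
    idx₂-inj : Injective _≡_ _≡_ idx₂
    idx₃-inj : Injective _≡_ _≡_ idx₃
    sym-inj  : Injective _≡_ _≡_ sym
    sub      : Cube m
    sub-latin : IsLatinCube sub
    sub-agrees : ∀ i j k → L (idx₁ i) (idx₂ j) (idx₃ k) ≡ sym (sub i j k)

record Disjoint {N : ℕ} {L : Cube N} {m m′ : ℕ}
                (S : Subcube L m) (T : Subcube L m′) : Set where
  private
    module S = Subcube S
    module T = Subcube T
  field
    disj₁   : ∀ a b → S.idx₁ a ≢ T.idx₁ b
    disj₂   : ∀ a b → S.idx₂ a ≢ T.idx₂ b
    disj₃   : ∀ a b → S.idx₃ a ≢ T.idx₃ b
    disjSym : ∀ a b → S.sym a ≢ T.sym b

total : {n : ℕ} → (Fin n → ℕ) → ℕ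
total {n} h = sum (map h (allFin n))

record LC {n : ℕ} (h : Fin n → ℕ) : Set where
  field
    cube     : Cube (total h)
    latin    : IsLatinCube cube
    subcube  : (i : Fin n) → Subcube cube (h i)
    disjoint : ∀ i j → i ≢ j → Disjoint (subcube i) (subcube j)

-- Let S be a subcube of order m and pick a layer l (third coordinate) that
-- misses S; it exists because a second, disjoint subcube occupies some layer.
-- Fix a first index of S and run the second index over S. In S the
-- third-direction line through each such cell already carries every symbol
-- of S, so the m cells met in layer l carry m distinct symbols outside S.
-- Together with the m symbols of S this gives 2m ≤ N.
module Submission where

open import Defs
open import Data.Nat using (ℕ; _≤_; _<_; _*_; _+_; suc; s≤s)
open import Data.Nat.Properties using (+-identityʳ; 1+n≰n)
open import Data.Fin using (Fin; zero; suc; splitAt; fromℕ<; _≟_)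
import Data.Fin as F
open import Data.Fin.Properties using (injective⇒≤; any?; +↔⊎)
open import Data.Sum using (inj₁; inj₂; [_,_]′)
open import Data.Product using (∃; _,_)
open import Function.Bundles using (Injection)
open import Function.Definitions using (Injective)
open import Function.Properties.Inverse using (↔⇒↣)
open import Relation.Binary.PropositionalEquality
open import Relation.Nullary using (yes; no; contradiction)

distinct⇒injective : ∀ {a} {A : Set a} {m} {f : Fin m → A} →
                     (∀ {x y} → x ≢ y → f x ≢ f y) → Injective _≡_ _≡_ f
distinct⇒injective distinct {x} {y} fx≡fy with x ≟ y
... | yes x≡y = x≡y
... | no  x≢y = contradiction fx≡fy (distinct x≢y)

injective⇒surjective : ∀ {m} {f : Fin m → Fin m} → Injective _≡_ _≡_ f →
                       ∀ s → ∃ λ k → f k ≡ s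
injective⇒surjective {m} {f} f-injective s with any? (λ k → f k ≟ s)
... | yes hit  = hit
... | no  miss = contradiction (injective⇒≤ extended-injective) 1+n≰n
  where
  extended : Fin (suc m) → Fin m
  extended zero    = s
  extended (suc k) = f k

  extended-injective : Injective _≡_ _≡_ extended
  extended-injective {zero}  {zero}  _ = refl
  extended-injective {zero}  {suc y} e = contradiction (y , sym e) miss
  extended-injective {suc x} {zero}  e = contradiction (x , e) miss
  extended-injective {suc x} {suc y} e = cong suc (f-injective e)

disjoint-images⇒≤ : ∀ {m k N} {f : Fin m → Fin N} {g : Fin k → Fin N} →
                    Injective _≡_ _≡_ f → Injective _≡_ _≡_ g →
                    (∀ a b → f a ≢ g b) → m + k ≤ N
disjoint-images⇒≤ {m} {k} {f = f} {g} f-inj g-inj f≢g =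
  injective⇒≤ (λ e → splitAt-injective ([f,g]-injective _ _ e))
  where
  splitAt-injective : Injective _≡_ _≡_ (splitAt m {k})
  splitAt-injective = Injection.injective (↔⇒↣ +↔⊎)

  [f,g]-injective : ∀ x y → [ f , g ]′ x ≡ [ f , g ]′ y → x ≡ y
  [f,g]-injective (inj₁ a) (inj₁ b) e = cong inj₁ (f-inj e)
  [f,g]-injective (inj₁ a) (inj₂ b) e = contradiction e (f≢g a b)
  [f,g]-injective (inj₂ a) (inj₁ b) e = contradiction (sym e) (f≢g b a)
  [f,g]-injective (inj₂ a) (inj₂ b) e = cong inj₂ (g-inj e)

module _ {N} {L : Cube N} (latin : IsLatinCube L) where
  open IsLatinCube

  line₂-injective : ∀ i k → Injective _≡_ _≡_ (λ j → L i j k)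
  line₂-injective i k = distinct⇒injective (λ {j} {j′} → line₂ latin i {j} {j′} k)

  line₃-injective : ∀ i j → Injective _≡_ _≡_ (L i j)
  line₃-injective i j = distinct⇒injective (λ {k} {k′} → line₃ latin i j {k} {k′})

module _ {N m} {L : Cube N} (latin : IsLatinCube L) (S : Subcube L m) where
  open Subcube S renaming (sym to σ)

  off-layer-symbol-∉ : ∀ {l} → (∀ k → idx₃ k ≢ l) →
                       ∀ a b s → L (idx₁ a) (idx₂ b) l ≢ σ s
  off-layer-symbol-∉ {l} l∉idx₃ a b s L≡σs
    with k , sub≡s ← injective⇒surjective (line₃-injective sub-latin a b) s =
    IsLatinCube.line₃ latin (idx₁ a) (idx₂ b) (l∉idx₃ k) (begin
      L (idx₁ a) (idx₂ b) (idx₃ k) ≡⟨ sub-agrees a b k ⟩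
      σ (sub a b k)                ≡⟨ cong σ sub≡s ⟩
      σ s                          ≡⟨ sym L≡σs ⟩
      L (idx₁ a) (idx₂ b) l        ∎)
    where open ≡-Reasoning

  order+order≤ : ∀ {l} → (∀ k → idx₃ k ≢ l) → Fin m → m + m ≤ N
  order+order≤ {l} l∉idx₃ a = disjoint-images⇒≤
    (λ e → idx₂-inj (line₂-injective latin (idx₁ a) l e))
    sym-inj (off-layer-symbol-∉ l∉idx₃ a)

another : ∀ {n} → 2 ≤ n → (i : Fin n) → ∃ λ j → i ≢ j
another (s≤s (s≤s _)) zero    = suc zero , λ ()
another (s≤s (s≤s _)) (suc _) = zero , λ ()

theorem9 : (n : ℕ) (h : Fin n → ℕ) → 2 ≤ n
    → (∀ i j → i F.≤ j → h j ≤ h i)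
    → (∀ i → 0 < h i)
    → LC h
    → ∀ i → 2 * h i ≤ total h
theorem9 n h 2≤n _ positive lc i with j , i≢j ← another 2≤n i =
  subst (_≤ total h) (cong (h i +_) (sym (+-identityʳ (h i))))
    (order+order≤ latin (subcube i) l∉idxᵢ (fromℕ< (positive i)))
  where
  open LC lc
  l = Subcube.idx₃ (subcube j) (fromℕ< (positive j))

  l∉idxᵢ : ∀ k → Subcube.idx₃ (subcube i) k ≢ l
  l∉idxᵢ k = Disjoint.disj₃ (disjoint i j i≢j) k (fromℕ< (positive j))
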